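{- Let $n\ge 1$ and let $L_S$ be the $(4n+1)\times(4n+1)$ symmetric tridiagonal matrix whose off-diagonal entries $(L_S)_{j,j+1}=(L_S)_{j+1,j}$ are all $-1$ and whose diagonal entries are $d_1=d_{4n+1}=3$ and, for $2\le j\le 4n$, $d_j=4$ if $j\equiv 0$ or $1 \pmod 4$ and $d_j=2$ if $j\equiv 2$ or $3\pmod 4$. Write $\det(xI-L_S)=x^{4n+1}+b_1x^{4n}+\cdots+b_{4n}x+b_{4n+1}$ (so $(-1)^{4n}b_{4n}$ equals the sum of all principal minors of $L_S$ of order $4n$). Put $A=15+4\sqrt{14}$, $B=15-4\sqrt{14}$. Then \[ (-1)^{4n}b_{4n}=\frac{1}{196}\big[(98+33\sqrt{14})A^{n}+(98-33\sqrt{14})B^{n}\big]+\frac{9n}{14}\big[(4+\sqrt{14})A^{n}+(4-\sqrt{14})B^{n}\big]. \]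
   Context: The matrix $L_S$ arises as $L_{V_1V_1}-L_{V_1V_2}$ for the Laplacian of the linear octagonal-quadrilateral network $L_n$ (vertices $1,\dots,4n+1$, $1',\dots,(4n+1)'$; edges $\{j,j+1\}$, $\{j',(j+1)'\}$ for $1\le j\le 4n$, and $\{j,j'\}$ for $j=1$ and for $j\equiv 0,1 \pmod 4$, $4\le j\le 4n+1$), with $V_1=\{1,\dots,4n+1\}$, $V_2=\{1',\dots,(4n+1)'\}$. -}

module Defs where

open import Data.Nat as ℕ using (ℕ; zero; suc)
open import Data.Nat.DivMod using (_%_)
open import Data.Fin using (Fin; zero; suc; toℕ; punchIn)
open import Data.Integer as ℤ using (ℤ; +_; -[1+_])
open import Data.Rational as ℚ using (ℚ)
open import Data.List using (List; []; _∷_; map)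
open import Data.Bool using (Bool; true; false; if_then_else_; _∨_)
open import Data.Product using (_×_; _,_)

-- Univariate polynomials over ℤ as coefficient lists (lowest degree first)

Poly : Set
Poly = List ℤ

addP : Poly → Poly → Poly
addP [] q = q
addP (a ∷ p) [] = a ∷ p
addP (a ∷ p) (b ∷ q) = (a ℤ.+ b) ∷ addP p q

scaleP : ℤ → Poly → Poly
scaleP c p = map (c ℤ.*_) p

mulP : Poly → Poly → Poly
mulP [] q = []
mulP (a ∷ p) q = addP (scaleP a q) (+ 0 ∷ mulP p q)

constP : ℤ → Poly
constP c = c ∷ []

X : Poly
X = + 0 ∷ + 1 ∷ []

coeff : Poly → ℕ → ℤ
coeff [] k = + 0
coeff (a ∷ p) zero = a
coeff (a ∷ p) (suc k) = coeff p k

sgn : ℕ → ℤ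
sgn zero = + 1
sgn (suc k) = ℤ.- sgn k

sumFinP : ∀ {n} → (Fin n → Poly) → Poly
sumFinP {zero} f = []
sumFinP {suc n} f = addP (f zero) (sumFinP (λ i → f (suc i)))

detP : ∀ n → (Fin n → Fin n → Poly) → Poly
detP zero M = constP (+ 1)
detP (suc n) M =
  sumFinP (λ j → scaleP (sgn (toℕ j))
                   (mulP (M zero j) (detP n (λ i k → M (suc i) (punchIn j k)))))

-- The matrix L_S of size (4n+1)×(4n+1); index i : Fin (4n+1) stands for j = i+1.

eqℕ : ℕ → ℕ → Bool
eqℕ zero zero = true
eqℕ zero (suc m) = false
eqℕ (suc k) zero = false
eqℕ (suc k) (suc m) = eqℕ k m

-- diagonal entry d_j (1-based j), for the matrix of size 4n+1
diagEntry : ℕ → ℕ → ℤ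
diagEntry n j =
  if eqℕ j 1 ∨ eqℕ j (suc (4 ℕ.* n)) then + 3
  else (if eqℕ (j % 4) 0 ∨ eqℕ (j % 4) 1 then + 4 else + 2)

LS : (n : ℕ) → Fin (suc (4 ℕ.* n)) → Fin (suc (4 ℕ.* n)) → ℤ
LS n i k =
  if eqℕ (toℕ i) (toℕ k) then diagEntry n (suc (toℕ i))
  else (if eqℕ (suc (toℕ i)) (toℕ k) ∨ eqℕ (toℕ i) (suc (toℕ k)) then -[1+ 0 ] else + 0)

xI-LS : (n : ℕ) → Fin (suc (4 ℕ.* n)) → Fin (suc (4 ℕ.* n)) → Poly
xI-LS n i k =
  addP (if eqℕ (toℕ i) (toℕ k) then X else [])
       (constP (ℤ.- LS n i k))

charPoly : ℕ → Poly
charPoly n = detP (suc (4 ℕ.* n)) (xI-LS n)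

b : ℕ → ℕ → ℤ
b n k = coeff (charPoly n) (suc (4 ℕ.* n) ℕ.∸ k)

-- ℚ(√14): pair (a , c) denotes a + c√14

Q14 : Set
Q14 = ℚ × ℚ

infixl 6 _+q_
infixl 7 _*q_
infixr 8 _^q_

_+q_ : Q14 → Q14 → Q14
(a , c) +q (a' , c') = (a ℚ.+ a') , (c ℚ.+ c')

_*q_ : Q14 → Q14 → Q14
(a , c) *q (a' , c') =
  ((a ℚ.* a') ℚ.+ ((+ 14 ℚ./ 1) ℚ.* (c ℚ.* c'))) , ((a ℚ.* c') ℚ.+ (c ℚ.* a'))

_^q_ : Q14 → ℕ → Q14
x ^q zero = (ℚ.1ℚ , ℚ.0ℚ)
x ^q suc k = x *q (x ^q k)

ofℤ : ℤ → ℤ → Q14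
ofℤ a c = (a ℚ./ 1) , (c ℚ./ 1)

Aq : Q14
Aq = ofℤ (+ 15) (+ 4)

Bq : Q14
Bq = ofℤ (+ 15) (ℤ.- (+ 4))

rhs : ℕ → Q14
rhs n =
  ((+ 1 ℚ./ 196) , ℚ.0ℚ) *q
    ((ofℤ (+ 98) (+ 33) *q (Aq ^q n)) +q (ofℤ (+ 98) (ℤ.- (+ 33)) *q (Bq ^q n)))
  +q
  (((+ (9 ℕ.* n) ℚ./ 14) , ℚ.0ℚ) *q
    ((ofℤ (+ 4) (+ 1) *q (Aq ^q n)) +q (ofℤ (+ 4) (ℤ.- (+ 1)) *q (Bq ^q n))))

embℤ : ℤ → Q14
embℤ a = ofℤ a (+ 0)

-- Because (−1)^(4n) = 1, the quantity is the coefficient of x in det(xI − L_S), so the determinant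
-- only needs to be known modulo x², i.e. over the dual numbers ℤ[ε]. The matrix is tridiagonal with
-- off-diagonal entries 1, so its trailing principal minors obey the continuant recurrence
-- K_{s+1} = (x − d) K_s − K_{s−1}. Taking the rows four at a time (diagonal 4, 4, 2, 2) turns this
-- into a fixed linear map whose constant part has eigenvalues A = 15 + 4√14 and B = 15 − 4√14.
-- Hence the minors at block boundaries have closed forms α x_t + β y_t + t (γ x_t + δ y_t), where
-- x_t + y_t √14 = A^t, and checking them reduces to a computation on the coefficients α, β, γ, δ.
-- Substituting A^n = x_n + y_n √14 and B^n = x_n − y_n √14 turns the right-hand side into the
-- same integer.

module Submission where

open import Defs
open import Data.Nat using (ℕ; _≥_)
open import Data.Integer using (_*_)
open import Relation.Binary.PropositionalEquality using (_≡_)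

open import Data.Nat as ℕ using (zero; suc; _<_; s≤s; z≤n)
import Data.Nat.Properties as ℕₚ
open import Data.Integer using (ℤ; +_; -[1+_]; _+_; -_)
import Data.Integer.Properties as ℤₚ
open import Data.Integer.Tactic.RingSolver using (solve-∀)
open import Data.Fin using (Fin; zero; suc; toℕ; punchIn)
open import Data.List using ([]; _∷_)
open import Data.Bool using (Bool; true; false; if_then_else_; _∨_)
open import Data.Bool.Properties using (∨-zeroʳ)
open import Data.Empty using (⊥-elim)
open import Data.Nat.DivMod using (_%_; [m+kn]%n≡m%n; m*n%n≡0)
open import Data.Rational as ℚ using (0ℚ)
import Data.Rational.Properties as ℚₚ
open import Data.Rational.Unnormalised as ℚᵘ using (mkℚᵘ; *≡*) renaming (_≃_ to _≃ᵘ_)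
import Data.Rational.Unnormalised.Properties as ℚᵘₚ
open import Data.Product using (_×_; _,_; proj₁; proj₂)
open import Relation.Binary.PropositionalEquality using (_≢_; refl; sym; trans; cong; cong₂; subst; module ≡-Reasoning)

infix  5 _+ε_
infixl 6 _+ᴰ_ _-ᴰ_
infixl 7 _*ᴰ_
infixr 7 _·_

data Dual : Set where
  _+ε_ : ℤ → ℤ → Dual

value slope : Dual → ℤ
value (a +ε b) = a
slope (a +ε b) = b

0ᴰ 1ᴰ : Dual
0ᴰ = + 0 +ε + 0
1ᴰ = + 1 +ε + 0

_+ᴰ_ : Dual → Dual → Dual
(a +ε b) +ᴰ (c +ε d) = a + c +ε b + d

_*ᴰ_ : Dual → Dual → Dual
(a +ε b) *ᴰ (c +ε d) = a * c +ε a * d + b * c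

_·_ : ℤ → Dual → Dual
k · (a +ε b) = k * a +ε k * b

_-ᴰ_ : Dual → Dual → Dual
x -ᴰ y = x +ᴰ -[1+ 0 ] · y

+ᴰ-identityʳ : ∀ x → x +ᴰ 0ᴰ ≡ x
+ᴰ-identityʳ (a +ε b) = cong₂ _+ε_ (ℤₚ.+-identityʳ a) (ℤₚ.+-identityʳ b)

*ᴰ-identityˡ : ∀ x → 1ᴰ *ᴰ x ≡ x
*ᴰ-identityˡ (a +ε b) = cong₂ _+ε_ (ℤₚ.*-identityˡ a) (trans (ℤₚ.+-identityʳ (+ 1 * b)) (ℤₚ.*-identityˡ b))

*ᴰ-identityʳ : ∀ x → x *ᴰ 1ᴰ ≡ x
*ᴰ-identityʳ (a +ε b) = cong₂ _+ε_ (ℤₚ.*-identityʳ a)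
  (trans (cong₂ _+_ (ℤₚ.*-zeroʳ a) (ℤₚ.*-identityʳ b)) (ℤₚ.+-identityˡ b))

*ᴰ-zeroˡ : ∀ x → 0ᴰ *ᴰ x ≡ 0ᴰ
*ᴰ-zeroˡ (a +ε b) = cong₂ _+ε_ (ℤₚ.*-zeroˡ a) (cong₂ _+_ (ℤₚ.*-zeroˡ b) (ℤₚ.*-zeroˡ a))

*ᴰ-zeroʳ : ∀ x → x *ᴰ 0ᴰ ≡ 0ᴰ
*ᴰ-zeroʳ (a +ε b) = cong₂ _+ε_ (ℤₚ.*-zeroʳ a) (cong₂ _+_ (ℤₚ.*-zeroʳ a) (ℤₚ.*-zeroʳ b))

·-identityˡ : ∀ x → + 1 · x ≡ x
·-identityˡ (a +ε b) = cong₂ _+ε_ (ℤₚ.*-identityˡ a) (ℤₚ.*-identityˡ b)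

·-zeroʳ : ∀ k → k · 0ᴰ ≡ 0ᴰ
·-zeroʳ k = cong₂ _+ε_ (ℤₚ.*-zeroʳ k) (ℤₚ.*-zeroʳ k)

·-*ᴰ-zeroˡ : ∀ k {x} y → x ≡ 0ᴰ → k · (x *ᴰ y) ≡ 0ᴰ
·-*ᴰ-zeroˡ k y refl = trans (cong (k ·_) (*ᴰ-zeroˡ y)) (·-zeroʳ k)

·-*ᴰ-zeroʳ : ∀ k x {y} → y ≡ 0ᴰ → k · (x *ᴰ y) ≡ 0ᴰ
·-*ᴰ-zeroʳ k x refl = trans (cong (k ·_) (*ᴰ-zeroʳ x)) (·-zeroʳ k)

coeff-addP : ∀ p q k → coeff (addP p q) k ≡ coeff p k + coeff q k
coeff-addP []      q       k       = sym (ℤₚ.+-identityˡ (coeff q k))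
coeff-addP (a ∷ p) []      k       = sym (ℤₚ.+-identityʳ (coeff (a ∷ p) k))
coeff-addP (a ∷ p) (b ∷ q) zero    = refl
coeff-addP (a ∷ p) (b ∷ q) (suc k) = coeff-addP p q k

coeff-scaleP : ∀ c p k → coeff (scaleP c p) k ≡ c * coeff p k
coeff-scaleP c []      k       = sym (ℤₚ.*-zeroʳ c)
coeff-scaleP c (a ∷ p) zero    = refl
coeff-scaleP c (a ∷ p) (suc k) = coeff-scaleP c p k

coeff₀-mulP : ∀ p q → coeff (mulP p q) 0 ≡ coeff p 0 * coeff q 0
coeff₀-mulP []      q = sym (ℤₚ.*-zeroˡ (coeff q 0))
coeff₀-mulP (a ∷ p) q = begin
  coeff (addP (scaleP a q) (+ 0 ∷ mulP p q)) 0 ≡⟨ coeff-addP (scaleP a q) _ 0 ⟩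
  coeff (scaleP a q) 0 + + 0                   ≡⟨ ℤₚ.+-identityʳ _ ⟩
  coeff (scaleP a q) 0                         ≡⟨ coeff-scaleP a q 0 ⟩
  a * coeff q 0                                ∎
  where open ≡-Reasoning

coeff₁-mulP : ∀ p q → coeff (mulP p q) 1 ≡ coeff p 0 * coeff q 1 + coeff p 1 * coeff q 0
coeff₁-mulP []      q = refl
coeff₁-mulP (a ∷ p) q = trans (coeff-addP (scaleP a q) _ 1) (cong₂ _+_ (coeff-scaleP a q 1) (coeff₀-mulP p q))

trunc₁ : Poly → Dual
trunc₁ p = coeff p 0 +ε coeff p 1

trunc₁-addP : ∀ p q → trunc₁ (addP p q) ≡ trunc₁ p +ᴰ trunc₁ q
trunc₁-addP p q = cong₂ _+ε_ (coeff-addP p q 0) (coeff-addP p q 1)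

trunc₁-scaleP : ∀ c p → trunc₁ (scaleP c p) ≡ c · trunc₁ p
trunc₁-scaleP c p = cong₂ _+ε_ (coeff-scaleP c p 0) (coeff-scaleP c p 1)

trunc₁-mulP : ∀ p q → trunc₁ (mulP p q) ≡ trunc₁ p *ᴰ trunc₁ q
trunc₁-mulP p q = cong₂ _+ε_ (coeff₀-mulP p q) (coeff₁-mulP p q)

-- Determinants over the dual numbers

sumᴰ : ∀ {m} → (Fin m → Dual) → Dual
sumᴰ {zero}  f = 0ᴰ
sumᴰ {suc m} f = f zero +ᴰ sumᴰ (λ i → f (suc i))

dropRow₀Col : ∀ {m} {A : Set} → (Fin (suc m) → Fin (suc m) → A) → Fin (suc m) → Fin m → Fin m → A
dropRow₀Col M j i k = M (suc i) (punchIn j k)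

detᴰ : ∀ m → (Fin m → Fin m → Dual) → Dual
detᴰ zero    M = 1ᴰ
detᴰ (suc m) M = sumᴰ (λ j → sgn (toℕ j) · (M zero j *ᴰ detᴰ m (dropRow₀Col M j)))

laplaceTerm : ∀ {m} → (Fin (suc m) → Fin (suc m) → Dual) → Fin (suc m) → Dual
laplaceTerm {m} M j = sgn (toℕ j) · (M zero j *ᴰ detᴰ m (dropRow₀Col M j))

sumᴰ-cong : ∀ {m} {f g : Fin m → Dual} → (∀ i → f i ≡ g i) → sumᴰ f ≡ sumᴰ g
sumᴰ-cong {zero}  f≡g = refl
sumᴰ-cong {suc m} f≡g = cong₂ _+ᴰ_ (f≡g zero) (sumᴰ-cong (λ i → f≡g (suc i)))

sumᴰ-zero : ∀ {m} {f : Fin m → Dual} → (∀ i → f i ≡ 0ᴰ) → sumᴰ f ≡ 0ᴰ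
sumᴰ-zero {zero}  f≡0 = refl
sumᴰ-zero {suc m} f≡0 = cong₂ _+ᴰ_ (f≡0 zero) (sumᴰ-zero (λ i → f≡0 (suc i)))

trunc₁-sumFinP : ∀ {m} (f : Fin m → Poly) → trunc₁ (sumFinP f) ≡ sumᴰ (λ i → trunc₁ (f i))
trunc₁-sumFinP {zero}  f = refl
trunc₁-sumFinP {suc m} f =
  trans (trunc₁-addP (f zero) _) (cong (trunc₁ (f zero) +ᴰ_) (trunc₁-sumFinP (λ i → f (suc i))))

trunc₁-detP : ∀ m M → trunc₁ (detP m M) ≡ detᴰ m (λ i k → trunc₁ (M i k))
trunc₁-detP zero    M = refl
trunc₁-detP (suc m) M = trans (trunc₁-sumFinP term) (sumᴰ-cong trunc₁-term)
  where
  open ≡-Reasoning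
  term : Fin (suc m) → Poly
  term j = scaleP (sgn (toℕ j)) (mulP (M zero j) (detP m (dropRow₀Col M j)))
  trunc₁-term : ∀ j → trunc₁ (term j) ≡ laplaceTerm (λ i k → trunc₁ (M i k)) j
  trunc₁-term j = begin
    trunc₁ (scaleP s (mulP a d))   ≡⟨ trunc₁-scaleP s (mulP a d) ⟩
    s · trunc₁ (mulP a d)          ≡⟨ cong (s ·_) (trunc₁-mulP a d) ⟩
    s · (trunc₁ a *ᴰ trunc₁ d)     ≡⟨ cong (λ x → s · (trunc₁ a *ᴰ x)) (trunc₁-detP m (dropRow₀Col M j)) ⟩
    s · (trunc₁ a *ᴰ detᴰ m (λ i k → trunc₁ (dropRow₀Col M j i k))) ∎
    where
    s = sgn (toℕ j)
    a = M zero j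
    d = detP m (dropRow₀Col M j)

detᴰ-cong : ∀ m {M N : Fin m → Fin m → Dual} → (∀ i k → M i k ≡ N i k) → detᴰ m M ≡ detᴰ m N
detᴰ-cong zero    M≡N = refl
detᴰ-cong (suc m) M≡N = sumᴰ-cong λ j →
  cong₂ (λ a d → sgn (toℕ j) · (a *ᴰ d)) (M≡N zero j) (detᴰ-cong m (λ i k → M≡N (suc i) (punchIn j k)))

detᴰ-zeroColumn : ∀ {m} (M : Fin (suc m) → Fin (suc m) → Dual) → (∀ i → M i zero ≡ 0ᴰ) →
                  detᴰ (suc m) M ≡ 0ᴰ
detᴰ-zeroColumn {m} M col≡0 = sumᴰ-zero (term m M col≡0)
  where
  term : ∀ m (M : Fin (suc m) → Fin (suc m) → Dual) → (∀ i → M i zero ≡ 0ᴰ) →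
         ∀ j → laplaceTerm M j ≡ 0ᴰ
  term m       M col≡0 zero    = ·-*ᴰ-zeroˡ (+ 1) (detᴰ m (dropRow₀Col M zero)) (col≡0 zero)
  term (suc m) M col≡0 (suc j) = ·-*ᴰ-zeroʳ (sgn (toℕ (suc j))) (M zero (suc j))
    (detᴰ-zeroColumn (dropRow₀Col M (suc j)) (λ i → col≡0 (suc i)))

detᴰ-column₀ : ∀ {m} (M : Fin (suc m) → Fin (suc m) → Dual) → (∀ i → M (suc i) zero ≡ 0ᴰ) →
               detᴰ (suc m) M ≡ M zero zero *ᴰ detᴰ m (dropRow₀Col M zero)
detᴰ-column₀ {m} M col≡0 = begin
  laplaceTerm M zero +ᴰ sumᴰ (λ j → laplaceTerm M (suc j))
    ≡⟨ cong (laplaceTerm M zero +ᴰ_) (sumᴰ-zero (later m M col≡0)) ⟩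
  laplaceTerm M zero +ᴰ 0ᴰ
    ≡⟨ +ᴰ-identityʳ (laplaceTerm M zero) ⟩
  laplaceTerm M zero
    ≡⟨ ·-identityˡ (M zero zero *ᴰ detᴰ m (dropRow₀Col M zero)) ⟩
  M zero zero *ᴰ detᴰ m (dropRow₀Col M zero) ∎
  where
  open ≡-Reasoning
  later : ∀ m (M : Fin (suc m) → Fin (suc m) → Dual) → (∀ i → M (suc i) zero ≡ 0ᴰ) →
          ∀ j → laplaceTerm M (suc j) ≡ 0ᴰ
  later (suc m) M col≡0 j = ·-*ᴰ-zeroʳ (sgn (toℕ (suc j))) (M zero (suc j))
    (detᴰ-zeroColumn (dropRow₀Col M (suc j)) col≡0)

detᴰ-row₀ : ∀ {m} (M : Fin (suc (suc m)) → Fin (suc (suc m)) → Dual) → (∀ j → M zero (suc (suc j)) ≡ 0ᴰ) →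
            detᴰ (suc (suc m)) M ≡
              M zero zero *ᴰ detᴰ (suc m) (dropRow₀Col M zero)
              -ᴰ M zero (suc zero) *ᴰ detᴰ (suc m) (dropRow₀Col M (suc zero))
detᴰ-row₀ {m} M row≡0 = cong₂ _+ᴰ_ (·-identityˡ (M zero zero *ᴰ detᴰ (suc m) (dropRow₀Col M zero))) (begin
  second +ᴰ sumᴰ (λ j → laplaceTerm M (suc (suc j)))
    ≡⟨ cong (second +ᴰ_) (sumᴰ-zero (λ j → ·-*ᴰ-zeroˡ (sgn (toℕ (suc (suc j)))) _ (row≡0 j))) ⟩
  second +ᴰ 0ᴰ
    ≡⟨ +ᴰ-identityʳ second ⟩
  second ∎)
  where
  open ≡-Reasoning
  second = laplaceTerm M (suc zero)

-- Tridiagonal determinants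

shift : (ℕ → ℕ → Dual) → ℕ → ℕ → Dual
shift F a c = F (suc a) (suc c)

-- minor F r s is the s × s principal minor of F whose top left entry is F r r.
minor : (ℕ → ℕ → Dual) → ℕ → ℕ → Dual
minor F zero    s = detᴰ s (λ i k → F (toℕ i) (toℕ k))
minor F (suc r) s = minor (shift F) r s

minor-0 : ∀ F r → minor F r 0 ≡ 1ᴰ
minor-0 F zero    = refl
minor-0 F (suc r) = minor-0 (shift F) r

minor-1 : ∀ F r → minor F r 1 ≡ F r r
minor-1 F zero    = begin
  + 1 · (F 0 0 *ᴰ 1ᴰ) +ᴰ 0ᴰ ≡⟨ +ᴰ-identityʳ (+ 1 · (F 0 0 *ᴰ 1ᴰ)) ⟩
  + 1 · (F 0 0 *ᴰ 1ᴰ)       ≡⟨ ·-identityˡ (F 0 0 *ᴰ 1ᴰ) ⟩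
  F 0 0 *ᴰ 1ᴰ               ≡⟨ *ᴰ-identityʳ (F 0 0) ⟩
  F 0 0                     ∎
  where open ≡-Reasoning
minor-1 F (suc r) = minor-1 (shift F) r

IsTridiagonal : (ℕ → ℕ → Dual) → Set
IsTridiagonal F = ∀ {a c} → suc a < c → F a c ≡ 0ᴰ × F c a ≡ 0ᴰ

shift-tridiagonal : ∀ {F} → IsTridiagonal F → IsTridiagonal (shift F)
shift-tridiagonal tri 1+a<c = tri (s≤s 1+a<c)

minor-continuant : ∀ F → IsTridiagonal F → ∀ r s →
  minor F r (suc (suc s)) ≡
    F r r *ᴰ minor F (suc r) (suc s) -ᴰ F r (suc r) *ᴰ (F (suc r) r *ᴰ minor F (suc (suc r)) s)
minor-continuant F tri zero s =
  trans (detᴰ-row₀ M (λ j → proj₁ (tri (s≤s (s≤s z≤n)))))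
        (cong (λ d → F 0 0 *ᴰ minor F 1 (suc s) -ᴰ F 0 1 *ᴰ d)
              (detᴰ-column₀ (dropRow₀Col M (suc zero)) (λ i → proj₂ (tri (s≤s (s≤s z≤n))))))
  where
  M : Fin (suc (suc s)) → Fin (suc (suc s)) → Dual
  M i k = F (toℕ i) (toℕ k)
minor-continuant F tri (suc r) s = minor-continuant (shift F) (shift-tridiagonal tri) r s

continuantStep : Dual → Dual × Dual → Dual × Dual
continuantStep e (u , v) = e *ᴰ u -ᴰ v , u

-- The matrix xI − L_S modulo x²

eqℕ-refl : ∀ a → eqℕ a a ≡ true
eqℕ-refl zero    = refl
eqℕ-refl (suc a) = eqℕ-refl a

eqℕ-≢ : ∀ {a c} → a ≢ c → eqℕ a c ≡ false
eqℕ-≢ {zero}  {zero}  a≢c = ⊥-elim (a≢c refl)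
eqℕ-≢ {zero}  {suc c} a≢c = refl
eqℕ-≢ {suc a} {zero}  a≢c = refl
eqℕ-≢ {suc a} {suc c} a≢c = eqℕ-≢ (λ a≡c → a≢c (cong suc a≡c))

diagᴰ : ℤ → Dual
diagᴰ d = - d +ε + 1

-- Indices are 0-based: entry n a c is the (a + 1, c + 1) entry of xI − L_S modulo x².
entry : ℕ → ℕ → ℕ → Dual
entry n a c =
  if eqℕ a c then diagᴰ (diagEntry n (suc a))
  else (if eqℕ (suc a) c ∨ eqℕ a (suc c) then 1ᴰ else 0ᴰ)

trunc₁-entry : ∀ (diagonal adjacent : Bool) d →
  trunc₁ (addP (if diagonal then X else [])
               (constP (- (if diagonal then d else (if adjacent then -[1+ 0 ] else + 0)))))
  ≡ (if diagonal then diagᴰ d else (if adjacent then 1ᴰ else 0ᴰ))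
trunc₁-entry true  adjacent d = cong (_+ε + 1) (ℤₚ.+-identityˡ (- d))
trunc₁-entry false true     d = refl
trunc₁-entry false false    d = refl

trunc₁-xI-LS : ∀ n i k → trunc₁ (xI-LS n i k) ≡ entry n (toℕ i) (toℕ k)
trunc₁-xI-LS n i k = trunc₁-entry (eqℕ (toℕ i) (toℕ k))
  (eqℕ (suc (toℕ i)) (toℕ k) ∨ eqℕ (toℕ i) (suc (toℕ k))) (diagEntry n (suc (toℕ i)))

entry-diagonal : ∀ n a → entry n a a ≡ diagᴰ (diagEntry n (suc a))
entry-diagonal n a rewrite eqℕ-refl a = refl

entry-above : ∀ n a → entry n a (suc a) ≡ 1ᴰ
entry-above n a rewrite eqℕ-≢ (ℕₚ.<⇒≢ (ℕₚ.n<1+n a)) | eqℕ-refl a = refl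

entry-below : ∀ n a → entry n (suc a) a ≡ 1ᴰ
entry-below n a
  rewrite eqℕ-≢ (ℕₚ.>⇒≢ (ℕₚ.n<1+n a)) | eqℕ-≢ (ℕₚ.>⇒≢ (ℕₚ.m<n⇒m<1+n (ℕₚ.n<1+n a)))
        | eqℕ-refl a = refl

entry-tridiagonal : ∀ n → IsTridiagonal (entry n)
entry-tridiagonal n {a} {c} 1+a<c = far , far′
  where
  a<c = ℕₚ.<⇒≤ 1+a<c
  a<1+c = ℕₚ.m<n⇒m<1+n a<c
  far : entry n a c ≡ 0ᴰ
  far rewrite eqℕ-≢ (ℕₚ.<⇒≢ a<c) | eqℕ-≢ (ℕₚ.<⇒≢ 1+a<c) | eqℕ-≢ (ℕₚ.<⇒≢ a<1+c) = refl
  far′ : entry n c a ≡ 0ᴰ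
  far′ rewrite eqℕ-≢ (ℕₚ.>⇒≢ a<c) | eqℕ-≢ (ℕₚ.>⇒≢ a<1+c) | eqℕ-≢ (ℕₚ.>⇒≢ 1+a<c) = refl

residueDiag : ℕ → ℤ
residueDiag r = if eqℕ r 0 ∨ eqℕ r 1 then + 4 else + 2

%4≢0⇒+*4≢4* : ∀ r q n → r % 4 ≢ 0 → r ℕ.+ q ℕ.* 4 ≢ 4 ℕ.* n
%4≢0⇒+*4≢4* r q n r%4≢0 eq = r%4≢0 (begin
  r % 4                 ≡⟨ [m+kn]%n≡m%n r q 4 ⟨
  (r ℕ.+ q ℕ.* 4) % 4   ≡⟨ cong (_% 4) (trans eq (ℕₚ.*-comm 4 n)) ⟩
  (n ℕ.* 4) % 4         ≡⟨ m*n%n≡0 n 4 ⟩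
  0                     ∎)
  where open ≡-Reasoning

entry-periodic : ∀ n r q → suc r ℕ.+ q ℕ.* 4 ≢ 4 ℕ.* n →
  entry n (suc r ℕ.+ q ℕ.* 4) (suc r ℕ.+ q ℕ.* 4) ≡ diagᴰ (residueDiag ((2 ℕ.+ r) % 4))
entry-periodic n r q not-last = trans (entry-diagonal n (suc r ℕ.+ q ℕ.* 4)) (cong diagᴰ (begin
  (if eqℕ (suc r ℕ.+ q ℕ.* 4) (4 ℕ.* n) then + 3 else residueDiag ((2 ℕ.+ r ℕ.+ q ℕ.* 4) % 4))
    ≡⟨ cong (λ b → if b then + 3 else residueDiag ((2 ℕ.+ r ℕ.+ q ℕ.* 4) % 4)) (eqℕ-≢ not-last) ⟩
  residueDiag ((2 ℕ.+ r ℕ.+ q ℕ.* 4) % 4)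
    ≡⟨ cong residueDiag ([m+kn]%n≡m%n (2 ℕ.+ r) q 4) ⟩
  residueDiag ((2 ℕ.+ r) % 4) ∎))
  where open ≡-Reasoning

entry-last : ∀ n → entry n (4 ℕ.* n) (4 ℕ.* n) ≡ diagᴰ (+ 3)
entry-last n rewrite eqℕ-refl (4 ℕ.* n) | ∨-zeroʳ (eqℕ (4 ℕ.* n) 0) = refl

minorPair : ℕ → ℕ → ℕ → Dual × Dual
minorPair n r s = minor (entry n) r (suc s) , minor (entry n) (suc r) s

minorPair-step : ∀ n r s {e p} → entry n r r ≡ e → minorPair n (suc r) s ≡ p →
                 minorPair n r (suc s) ≡ continuantStep e p
minorPair-step n r s refl refl = cong (_, minor (entry n) (suc r) (suc s)) (begin
  minor (entry n) r (suc (suc s))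
    ≡⟨ minor-continuant (entry n) (entry-tridiagonal n) r s ⟩
  entry n r r *ᴰ minor (entry n) (suc r) (suc s) -ᴰ entry n r (suc r) *ᴰ (entry n (suc r) r *ᴰ v)
    ≡⟨ cong₂ (λ x y → entry n r r *ᴰ minor (entry n) (suc r) (suc s) -ᴰ x *ᴰ (y *ᴰ v))
             (entry-above n r) (entry-below n r) ⟩
  entry n r r *ᴰ minor (entry n) (suc r) (suc s) -ᴰ 1ᴰ *ᴰ (1ᴰ *ᴰ v)
    ≡⟨ cong (λ x → entry n r r *ᴰ minor (entry n) (suc r) (suc s) -ᴰ x)
            (trans (*ᴰ-identityˡ (1ᴰ *ᴰ v)) (*ᴰ-identityˡ v)) ⟩
  entry n r r *ᴰ minor (entry n) (suc r) (suc s) -ᴰ v ∎)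
  where
  open ≡-Reasoning
  v = minor (entry n) (suc (suc r)) s

block : Dual × Dual → Dual × Dual
block p = step (+ 2) (step (+ 2) (step (+ 4) (step (+ 4) p)))
  where
  step : ℤ → Dual × Dual → Dual × Dual
  step d = continuantStep (diagᴰ d)

-- The second component plays the minor of size −1: it makes continuantStep (x − 4) produce x − 3,
-- the last diagonal entry.
tails : ℕ → Dual × Dual
tails zero    = 1ᴰ , -[1+ 0 ] +ε + 0
tails (suc t) = block (tails t)

minorPair-block : ∀ n q t {p} → minorPair n (4 ℕ.+ q ℕ.* 4) (t ℕ.* 4) ≡ continuantStep (diagᴰ (+ 4)) p →
                  minorPair n (1 ℕ.+ q ℕ.* 4) (3 ℕ.+ t ℕ.* 4) ≡ block p
minorPair-block n q t below =
  minorPair-step n (1 ℕ.+ q ℕ.* 4) (2 ℕ.+ t ℕ.* 4) (entry-periodic n 0 q (%4≢0⇒+*4≢4* 1 q n λ ()))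
    (minorPair-step n (2 ℕ.+ q ℕ.* 4) (1 ℕ.+ t ℕ.* 4) (entry-periodic n 1 q (%4≢0⇒+*4≢4* 2 q n λ ()))
      (minorPair-step n (3 ℕ.+ q ℕ.* 4) (t ℕ.* 4) (entry-periodic n 2 q (%4≢0⇒+*4≢4* 3 q n λ ())) below))

minorPair-tails : ∀ n t q → q ℕ.+ suc t ≡ n → minorPair n (1 ℕ.+ q ℕ.* 4) (3 ℕ.+ t ℕ.* 4) ≡ tails (suc t)
minorPair-tails n zero q q+1≡n =
  minorPair-block n q 0 {tails zero} (cong₂ _,_ last (minor-0 (entry n) (5 ℕ.+ q ℕ.* 4)))
  where
  4+4q≡4n : 4 ℕ.+ q ℕ.* 4 ≡ 4 ℕ.* n
  4+4q≡4n = trans (cong (ℕ._* 4) (trans (ℕₚ.+-comm 1 q) q+1≡n)) (ℕₚ.*-comm n 4)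
  last : minor (entry n) (4 ℕ.+ q ℕ.* 4) 1 ≡ diagᴰ (+ 3)
  last = trans (minor-1 (entry n) (4 ℕ.+ q ℕ.* 4))
               (trans (cong (λ a → entry n a a) 4+4q≡4n) (entry-last n))
minorPair-tails n (suc t) q q+2+t≡n = minorPair-block n q (suc t) {tails (suc t)}
  (minorPair-step n (4 ℕ.+ q ℕ.* 4) (3 ℕ.+ t ℕ.* 4) (entry-periodic n 3 q not-last)
                  (minorPair-tails n t (suc q) (trans (sym (ℕₚ.+-suc q (suc t))) q+2+t≡n)))
  where
  not-last : 4 ℕ.+ q ℕ.* 4 ≢ 4 ℕ.* n
  not-last eq = ℕₚ.m≢1+m+n (suc q) (begin
    suc q                     ≡⟨ ℕₚ.*-cancelʳ-≡ (suc q) n 4 (trans eq (ℕₚ.*-comm 4 n)) ⟩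
    n                         ≡⟨ q+2+t≡n ⟨
    q ℕ.+ suc (suc t)         ≡⟨ ℕₚ.+-suc q (suc t) ⟩
    suc (q ℕ.+ suc t)         ≡⟨ cong suc (ℕₚ.+-suc q t) ⟩
    suc (suc q ℕ.+ t)         ∎)
    where open ≡-Reasoning

trunc₁-charPoly : ∀ m → trunc₁ (charPoly (suc m)) ≡ proj₁ (continuantStep (diagᴰ (+ 3)) (tails (suc m)))
trunc₁-charPoly m = begin
  trunc₁ (charPoly n)
    ≡⟨ trunc₁-detP (suc (4 ℕ.* n)) (xI-LS n) ⟩
  detᴰ (suc (4 ℕ.* n)) (λ i k → trunc₁ (xI-LS n i k))
    ≡⟨ detᴰ-cong (suc (4 ℕ.* n)) (trunc₁-xI-LS n) ⟩
  minor (entry n) 0 (suc (4 ℕ.* n))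
    ≡⟨ cong (λ s → minor (entry n) 0 (suc s)) (ℕₚ.*-comm 4 n) ⟩
  proj₁ (minorPair n 0 (n ℕ.* 4))
    ≡⟨ cong proj₁ (minorPair-step n 0 (3 ℕ.+ m ℕ.* 4) refl (minorPair-tails n m 0 refl)) ⟩
  proj₁ (continuantStep (diagᴰ (+ 3)) (tails n)) ∎
  where
  open ≡-Reasoning
  n = suc m

-- Closed forms

-- pell t = (x , y) with x + y√14 = (15 + 4√14)^t.
pell : ℕ → ℤ × ℤ
pell zero    = + 1 , + 0
pell (suc t) = let (x , y) = pell t in + 15 * x + + 56 * y , + 4 * x + + 15 * y

data Form : Set where
  form : ℤ → ℤ → ℤ → ℤ → Form

⟦_⟧ : Form → ℕ → ℤ
⟦ form α β γ δ ⟧ t = let (x , y) = pell t in α * x + β * y + + t * (γ * x + δ * y)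

infixl 6 _+ᶠ_
infixr 7 _·ᶠ_

_+ᶠ_ : Form → Form → Form
form α β γ δ +ᶠ form α′ β′ γ′ δ′ = form (α + α′) (β + β′) (γ + γ′) (δ + δ′)

_·ᶠ_ : ℤ → Form → Form
k ·ᶠ form α β γ δ = form (k * α) (k * β) (k * γ) (k * δ)

shiftᶠ : Form → Form
shiftᶠ (form α β γ δ) =
  form (+ 15 * (α + γ) + + 4 * (β + δ)) (+ 56 * (α + γ) + + 15 * (β + δ)) (+ 15 * γ + + 4 * δ) (+ 56 * γ + + 15 * δ)

⟦⟧-+ᶠ : ∀ f g t → ⟦ f +ᶠ g ⟧ t ≡ ⟦ f ⟧ t + ⟦ g ⟧ t
⟦⟧-+ᶠ (form α β γ δ) (form α′ β′ γ′ δ′) t =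
  identity α β γ δ α′ β′ γ′ δ′ (proj₁ (pell t)) (proj₂ (pell t)) (+ t)
  where
  identity : ∀ α β γ δ α′ β′ γ′ δ′ x y t →
    (α + α′) * x + (β + β′) * y + t * ((γ + γ′) * x + (δ + δ′) * y)
      ≡ α * x + β * y + t * (γ * x + δ * y) + (α′ * x + β′ * y + t * (γ′ * x + δ′ * y))
  identity = solve-∀

⟦⟧-·ᶠ : ∀ k f t → ⟦ k ·ᶠ f ⟧ t ≡ k * ⟦ f ⟧ t
⟦⟧-·ᶠ k (form α β γ δ) t = identity k α β γ δ (proj₁ (pell t)) (proj₂ (pell t)) (+ t)
  where
  identity : ∀ k α β γ δ x y t →
    k * α * x + k * β * y + t * (k * γ * x + k * δ * y) ≡ k * (α * x + β * y + t * (γ * x + δ * y))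
  identity = solve-∀

⟦⟧-shiftᶠ : ∀ f t → ⟦ shiftᶠ f ⟧ t ≡ ⟦ f ⟧ (suc t)
⟦⟧-shiftᶠ (form α β γ δ) t = identity α β γ δ (proj₁ (pell t)) (proj₂ (pell t)) (+ t)
  where
  identity : ∀ α β γ δ x y t →
    (+ 15 * (α + γ) + + 4 * (β + δ)) * x + (+ 56 * (α + γ) + + 15 * (β + δ)) * y
      + t * ((+ 15 * γ + + 4 * δ) * x + (+ 56 * γ + + 15 * δ) * y)
    ≡ α * (+ 15 * x + + 56 * y) + β * (+ 4 * x + + 15 * y)
      + (+ 1 + t) * (γ * (+ 15 * x + + 56 * y) + δ * (+ 4 * x + + 15 * y))
  identity = solve-∀

DualForm : Set
DualForm = Form × Form

-- The factor 56 clears the denominators of the closed forms of the slopes.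
_≈_at_ : Dual → DualForm → ℕ → Set
x ≈ (f , g) at t = value x ≡ ⟦ f ⟧ t × + 56 * slope x ≡ ⟦ g ⟧ t

_≈²_at_ : Dual × Dual → DualForm × DualForm → ℕ → Set
(u , v) ≈² (U , V) at t = u ≈ U at t × v ≈ V at t

continuantStepᶠ : ℤ → DualForm × DualForm → DualForm × DualForm
continuantStepᶠ d ((f , g) , V) =
  (- d ·ᶠ f +ᶠ -[1+ 0 ] ·ᶠ proj₁ V , - d ·ᶠ g +ᶠ + 56 ·ᶠ f +ᶠ -[1+ 0 ] ·ᶠ proj₂ V) , (f , g)

continuantStep-≈² : ∀ d p P t → p ≈² P at t → continuantStep (diagᴰ d) p ≈² continuantStepᶠ d P at t
continuantStep-≈² d ((a +ε b) , (c +ε e)) ((f , g) , (f′ , g′)) t ((refl , 56b≡g) , (refl , 56e≡g′)) =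
  (valueEq , slopeEq) , (refl , 56b≡g)
  where
  open ≡-Reasoning
  valueEq : - d * a + -[1+ 0 ] * c ≡ ⟦ - d ·ᶠ f +ᶠ -[1+ 0 ] ·ᶠ f′ ⟧ t
  valueEq = sym (begin
    ⟦ - d ·ᶠ f +ᶠ -[1+ 0 ] ·ᶠ f′ ⟧ t
      ≡⟨ ⟦⟧-+ᶠ (- d ·ᶠ f) (-[1+ 0 ] ·ᶠ f′) t ⟩
    ⟦ - d ·ᶠ f ⟧ t + ⟦ -[1+ 0 ] ·ᶠ f′ ⟧ t
      ≡⟨ cong₂ _+_ (⟦⟧-·ᶠ (- d) f t) (⟦⟧-·ᶠ -[1+ 0 ] f′ t) ⟩
    - d * ⟦ f ⟧ t + -[1+ 0 ] * ⟦ f′ ⟧ t ∎)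
  rearrange : ∀ k a b e → + 56 * (k * b + + 1 * a + -[1+ 0 ] * e) ≡ k * (+ 56 * b) + + 56 * a + -[1+ 0 ] * (+ 56 * e)
  rearrange = solve-∀
  slopeEq : + 56 * (- d * b + + 1 * ⟦ f ⟧ t + -[1+ 0 ] * e) ≡ ⟦ - d ·ᶠ g +ᶠ + 56 ·ᶠ f +ᶠ -[1+ 0 ] ·ᶠ g′ ⟧ t
  slopeEq = begin
    + 56 * (- d * b + + 1 * ⟦ f ⟧ t + -[1+ 0 ] * e)
      ≡⟨ rearrange (- d) (⟦ f ⟧ t) b e ⟩
    - d * (+ 56 * b) + + 56 * ⟦ f ⟧ t + -[1+ 0 ] * (+ 56 * e)
      ≡⟨ cong₂ (λ x y → - d * x + + 56 * ⟦ f ⟧ t + -[1+ 0 ] * y) 56b≡g 56e≡g′ ⟩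
    - d * ⟦ g ⟧ t + + 56 * ⟦ f ⟧ t + -[1+ 0 ] * ⟦ g′ ⟧ t
      ≡⟨ cong₂ _+_ (cong₂ _+_ (⟦⟧-·ᶠ (- d) g t) (⟦⟧-·ᶠ (+ 56) f t)) (⟦⟧-·ᶠ -[1+ 0 ] g′ t) ⟨
    ⟦ - d ·ᶠ g ⟧ t + ⟦ + 56 ·ᶠ f ⟧ t + ⟦ -[1+ 0 ] ·ᶠ g′ ⟧ t
      ≡⟨ cong (_+ ⟦ -[1+ 0 ] ·ᶠ g′ ⟧ t) (⟦⟧-+ᶠ (- d ·ᶠ g) (+ 56 ·ᶠ f) t) ⟨
    ⟦ - d ·ᶠ g +ᶠ + 56 ·ᶠ f ⟧ t + ⟦ -[1+ 0 ] ·ᶠ g′ ⟧ t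
      ≡⟨ ⟦⟧-+ᶠ (- d ·ᶠ g +ᶠ + 56 ·ᶠ f) (-[1+ 0 ] ·ᶠ g′) t ⟨
    ⟦ - d ·ᶠ g +ᶠ + 56 ·ᶠ f +ᶠ -[1+ 0 ] ·ᶠ g′ ⟧ t ∎

blockᶠ : DualForm × DualForm → DualForm × DualForm
blockᶠ P = continuantStepᶠ (+ 2) (continuantStepᶠ (+ 2) (continuantStepᶠ (+ 4) (continuantStepᶠ (+ 4) P)))

block-≈² : ∀ p P t → p ≈² P at t → block p ≈² blockᶠ P at t
block-≈² p P t p≈P =
  continuantStep-≈² (+ 2) p₃ P₃ t (continuantStep-≈² (+ 2) p₂ P₂ t
    (continuantStep-≈² (+ 4) p₁ P₁ t (continuantStep-≈² (+ 4) p P t p≈P)))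
  where
  p₁ = continuantStep (diagᴰ (+ 4)) p
  p₂ = continuantStep (diagᴰ (+ 4)) p₁
  p₃ = continuantStep (diagᴰ (+ 2)) p₂
  P₁ = continuantStepᶠ (+ 4) P
  P₂ = continuantStepᶠ (+ 4) P₁
  P₃ = continuantStepᶠ (+ 2) P₂

tailsᶠ : DualForm × DualForm
tailsᶠ = (form (+ 1) (+ 3) (+ 0) (+ 0) , form (+ 0) (+ 69) (- + 108) (- + 504))
       , (form (- + 1) (- + 1) (+ 0) (+ 0) , form (+ 0) (- + 303) (+ 36) (+ 504))

shiftᶠ² : DualForm × DualForm → DualForm × DualForm
shiftᶠ² ((f , g) , (f′ , g′)) = (shiftᶠ f , shiftᶠ g) , (shiftᶠ f′ , shiftᶠ g′)

blockᶠ-tailsᶠ : blockᶠ tailsᶠ ≡ shiftᶠ² tailsᶠ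
blockᶠ-tailsᶠ = refl

shiftᶠ²-≈² : ∀ p P t → p ≈² shiftᶠ² P at t → p ≈² P at suc t
shiftᶠ²-≈² p ((f , g) , (f′ , g′)) t ((u₀ , u₁) , (v₀ , v₁)) =
  (move f u₀ , move g u₁) , (move f′ v₀ , move g′ v₁)
  where
  move : ∀ {z} h → z ≡ ⟦ shiftᶠ h ⟧ t → z ≡ ⟦ h ⟧ (suc t)
  move h z≡ = trans z≡ (⟦⟧-shiftᶠ h t)

tails-≈² : ∀ t → tails t ≈² tailsᶠ at t
tails-≈² zero    = (refl , refl) , (refl , refl)
tails-≈² (suc t) = shiftᶠ²-≈² (tails (suc t)) tailsᶠ t
  (subst (tails (suc t) ≈²_at t) blockᶠ-tailsᶠ (block-≈² (tails t) tailsᶠ t (tails-≈² t)))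

coeff₁-charPoly : ∀ m → + 56 * coeff (charPoly (suc m)) 1 ≡ ⟦ form (+ 56) (+ 264) (+ 288) (+ 1008) ⟧ (suc m)
coeff₁-charPoly m =
  trans (cong (λ x → + 56 * slope x) (trunc₁-charPoly m))
        (proj₂ (proj₁ (continuantStep-≈² (+ 3) (tails (suc m)) tailsᶠ (suc m) (tails-≈² (suc m)))))

toℚᵘ-/ : ∀ a k → ℚ.toℚᵘ (a ℚ./ suc k) ≃ᵘ mkℚᵘ a k
toℚᵘ-/ a k = ℚₚ.toℚᵘ-fromℚᵘ (mkℚᵘ a k)

/1-homo-+ : ∀ a b → a ℚ./ 1 ℚ.+ b ℚ./ 1 ≡ (a + b) ℚ./ 1
/1-homo-+ a b = ℚₚ.toℚᵘ-injective (begin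
  ℚ.toℚᵘ (a ℚ./ 1 ℚ.+ b ℚ./ 1)                ≈⟨ ℚₚ.toℚᵘ-homo-+ (a ℚ./ 1) (b ℚ./ 1) ⟩
  ℚ.toℚᵘ (a ℚ./ 1) ℚᵘ.+ ℚ.toℚᵘ (b ℚ./ 1)      ≈⟨ ℚᵘₚ.+-cong (toℚᵘ-/ a 0) (toℚᵘ-/ b 0) ⟩
  mkℚᵘ a 0 ℚᵘ.+ mkℚᵘ b 0                      ≈⟨ *≡* (identity a b) ⟩
  mkℚᵘ (a + b) 0                              ≈⟨ toℚᵘ-/ (a + b) 0 ⟨
  ℚ.toℚᵘ ((a + b) ℚ./ 1)                      ∎)
  where
  open ℚᵘₚ.≃-Reasoning
  identity : ∀ a b → (a * + 1 + b * + 1) * + 1 ≡ (a + b) * + 1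
  identity = solve-∀

/1-homo-* : ∀ a b → (a ℚ./ 1) ℚ.* (b ℚ./ 1) ≡ (a * b) ℚ./ 1
/1-homo-* a b = ℚₚ.toℚᵘ-injective (begin
  ℚ.toℚᵘ ((a ℚ./ 1) ℚ.* (b ℚ./ 1))                ≈⟨ ℚₚ.toℚᵘ-homo-* (a ℚ./ 1) (b ℚ./ 1) ⟩
  ℚ.toℚᵘ (a ℚ./ 1) ℚᵘ.* ℚ.toℚᵘ (b ℚ./ 1)      ≈⟨ ℚᵘₚ.*-cong (toℚᵘ-/ a 0) (toℚᵘ-/ b 0) ⟩
  mkℚᵘ (a * b) 0                              ≈⟨ toℚᵘ-/ (a * b) 0 ⟨
  ℚ.toℚᵘ ((a * b) ℚ./ 1)                      ∎)
  where open ℚᵘₚ.≃-Reasoning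

ofℤ-+q : ∀ a b c d → ofℤ a b +q ofℤ c d ≡ ofℤ (a + c) (b + d)
ofℤ-+q a b c d = cong₂ _,_ (/1-homo-+ a c) (/1-homo-+ b d)

ofℤ-*q : ∀ a b c d → ofℤ a b *q ofℤ c d ≡ ofℤ (a * c + + 14 * (b * d)) (a * d + b * c)
ofℤ-*q a b c d = cong₂ _,_
  (trans (cong₂ ℚ._+_ (/1-homo-* a c) (trans (cong ((+ 14 ℚ./ 1) ℚ.*_) (/1-homo-* b d)) (/1-homo-* (+ 14) (b * d))))
         (/1-homo-+ (a * c) (+ 14 * (b * d))))
  (trans (cong₂ ℚ._+_ (/1-homo-* a d) (/1-homo-* b c)) (/1-homo-+ (a * d) (b * c)))

Aq^q≡pell : ∀ t → Aq ^q t ≡ ofℤ (proj₁ (pell t)) (proj₂ (pell t))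
Aq^q≡pell zero    = refl
Aq^q≡pell (suc t) = trans (cong (Aq *q_) (Aq^q≡pell t))
  (trans (ofℤ-*q (+ 15) (+ 4) x y) (cong₂ ofℤ (identity₁ x y) (identity₂ x y)))
  where
  x = proj₁ (pell t)
  y = proj₂ (pell t)
  identity₁ : ∀ x y → + 15 * x + + 14 * (+ 4 * y) ≡ + 15 * x + + 56 * y
  identity₁ = solve-∀
  identity₂ : ∀ x y → + 15 * y + + 4 * x ≡ + 4 * x + + 15 * y
  identity₂ = solve-∀

Bq^q≡pell : ∀ t → Bq ^q t ≡ ofℤ (proj₁ (pell t)) (- proj₂ (pell t))
Bq^q≡pell zero    = refl
Bq^q≡pell (suc t) = trans (cong (Bq *q_) (Bq^q≡pell t))
  (trans (ofℤ-*q (+ 15) (- + 4) x (- y)) (cong₂ ofℤ (identity₁ x y) (identity₂ x y)))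
  where
  x = proj₁ (pell t)
  y = proj₂ (pell t)
  identity₁ : ∀ x y → + 15 * x + + 14 * (- + 4 * - y) ≡ + 15 * x + + 56 * y
  identity₁ = solve-∀
  identity₂ : ∀ x y → + 15 * - y + - + 4 * x ≡ - (+ 4 * x + + 15 * y)
  identity₂ = solve-∀

conjugate-sum : ∀ a b x y →
  ofℤ a b *q ofℤ x y +q ofℤ a (- b) *q ofℤ x (- y) ≡ ofℤ (+ 2 * (a * x + + 14 * (b * y))) (+ 0)
conjugate-sum a b x y = begin
  ofℤ a b *q ofℤ x y +q ofℤ a (- b) *q ofℤ x (- y)
    ≡⟨ cong₂ _+q_ (ofℤ-*q a b x y) (ofℤ-*q a (- b) x (- y)) ⟩
  ofℤ (a * x + + 14 * (b * y)) (a * y + b * x) +q ofℤ (a * x + + 14 * (- b * - y)) (a * - y + - b * x)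
    ≡⟨ ofℤ-+q (a * x + + 14 * (b * y)) (a * y + b * x) (a * x + + 14 * (- b * - y)) (a * - y + - b * x) ⟩
  ofℤ (a * x + + 14 * (b * y) + (a * x + + 14 * (- b * - y))) (a * y + b * x + (a * - y + - b * x))
    ≡⟨ cong₂ ofℤ (real a b x y) (imaginary a b x y) ⟩
  ofℤ (+ 2 * (a * x + + 14 * (b * y))) (+ 0) ∎
  where
  open ≡-Reasoning
  real : ∀ a b x y → a * x + + 14 * (b * y) + (a * x + + 14 * (- b * - y)) ≡ + 2 * (a * x + + 14 * (b * y))
  real = solve-∀
  imaginary : ∀ a b x y → a * y + b * x + (a * - y + - b * x) ≡ + 0
  imaginary = solve-∀

rational-*q : ∀ c s → (c , 0ℚ) *q ofℤ s (+ 0) ≡ (c ℚ.* (s ℚ./ 1) , 0ℚ)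
rational-*q c s = cong₂ _,_
  (trans (cong (λ z → c ℚ.* (s ℚ./ 1) ℚ.+ (+ 14 ℚ./ 1) ℚ.* z) (ℚₚ.*-zeroˡ 0ℚ))
         (trans (cong (c ℚ.* (s ℚ./ 1) ℚ.+_) (ℚₚ.*-zeroʳ (+ 14 ℚ./ 1))) (ℚₚ.+-identityʳ (c ℚ.* (s ℚ./ 1)))))
  (trans (cong (c ℚ.* 0ℚ ℚ.+_) (ℚₚ.*-zeroˡ (s ℚ./ 1)))
         (trans (ℚₚ.+-identityʳ (c ℚ.* 0ℚ)) (ℚₚ.*-zeroʳ c)))

fractions-sum : ∀ a b z m → + 14 * a + + 196 * (+ m * b) ≡ + 2744 * z →
  (+ 1 ℚ./ 196) ℚ.* (a ℚ./ 1) ℚ.+ (+ m ℚ./ 14) ℚ.* (b ℚ./ 1) ≡ z ℚ./ 1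
fractions-sum a b z m cross = ℚₚ.toℚᵘ-injective (begin
  ℚ.toℚᵘ ((+ 1 ℚ./ 196) ℚ.* (a ℚ./ 1) ℚ.+ (+ m ℚ./ 14) ℚ.* (b ℚ./ 1))
    ≈⟨ ℚₚ.toℚᵘ-homo-+ ((+ 1 ℚ./ 196) ℚ.* (a ℚ./ 1)) ((+ m ℚ./ 14) ℚ.* (b ℚ./ 1)) ⟩
  ℚ.toℚᵘ ((+ 1 ℚ./ 196) ℚ.* (a ℚ./ 1)) ℚᵘ.+ ℚ.toℚᵘ ((+ m ℚ./ 14) ℚ.* (b ℚ./ 1))
    ≈⟨ ℚᵘₚ.+-cong (toℚᵘ-fraction-* (+ 1) 195 a) (toℚᵘ-fraction-* (+ m) 13 b) ⟩
  mkℚᵘ (+ 1) 195 ℚᵘ.* mkℚᵘ a 0 ℚᵘ.+ mkℚᵘ (+ m) 13 ℚᵘ.* mkℚᵘ b 0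
    ≈⟨ *≡* (trans (identity a b (+ m)) (trans cross (ℤₚ.*-comm (+ 2744) z))) ⟩
  mkℚᵘ z 0
    ≈⟨ toℚᵘ-/ z 0 ⟨
  ℚ.toℚᵘ (z ℚ./ 1) ∎)
  where
  open ℚᵘₚ.≃-Reasoning
  toℚᵘ-fraction-* : ∀ c k a → ℚ.toℚᵘ ((c ℚ./ suc k) ℚ.* (a ℚ./ 1)) ≃ᵘ mkℚᵘ c k ℚᵘ.* mkℚᵘ a 0
  toℚᵘ-fraction-* c k a = ℚᵘₚ.≃-trans (ℚₚ.toℚᵘ-homo-* (c ℚ./ suc k) (a ℚ./ 1))
                                       (ℚᵘₚ.*-cong (toℚᵘ-/ c k) (toℚᵘ-/ a 0))
  identity : ∀ a b m → (+ 1 * a * + 14 + m * b * + 196) * + 1 ≡ + 14 * a + + 196 * (m * b)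
  identity = solve-∀

rhs≡embℤ : ∀ n z → + 56 * z ≡ ⟦ form (+ 56) (+ 264) (+ 288) (+ 1008) ⟧ n → rhs n ≡ embℤ z
rhs≡embℤ n z 56z≡ = begin
  rhs n
    ≡⟨ cong₂ (λ A B → (c₁ , 0ℚ) *q (ofℤ (+ 98) (+ 33) *q A +q ofℤ (+ 98) (- + 33) *q B)
                      +q (c₂ , 0ℚ) *q (ofℤ (+ 4) (+ 1) *q A +q ofℤ (+ 4) (- + 1) *q B))
             (Aq^q≡pell n) (Bq^q≡pell n) ⟩
  (c₁ , 0ℚ) *q (ofℤ (+ 98) (+ 33) *q ofℤ x y +q ofℤ (+ 98) (- + 33) *q ofℤ x (- y))
    +q (c₂ , 0ℚ) *q (ofℤ (+ 4) (+ 1) *q ofℤ x y +q ofℤ (+ 4) (- + 1) *q ofℤ x (- y))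
    ≡⟨ cong₂ (λ U V → (c₁ , 0ℚ) *q U +q (c₂ , 0ℚ) *q V)
             (conjugate-sum (+ 98) (+ 33) x y) (conjugate-sum (+ 4) (+ 1) x y) ⟩
  (c₁ , 0ℚ) *q ofℤ s₁ (+ 0) +q (c₂ , 0ℚ) *q ofℤ s₂ (+ 0)
    ≡⟨ cong₂ _+q_ (rational-*q c₁ s₁) (rational-*q c₂ s₂) ⟩
  (c₁ ℚ.* (s₁ ℚ./ 1) ℚ.+ c₂ ℚ.* (s₂ ℚ./ 1) , 0ℚ)
    ≡⟨ cong (_, 0ℚ) (fractions-sum s₁ s₂ z (9 ℕ.* n) cross) ⟩
  embℤ z ∎
  where
  open ≡-Reasoning
  c₁ = + 1 ℚ./ 196
  c₂ = + (9 ℕ.* n) ℚ./ 14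
  x = proj₁ (pell n)
  y = proj₂ (pell n)
  s₁ = + 2 * (+ 98 * x + + 14 * (+ 33 * y))
  s₂ = + 2 * (+ 4 * x + + 14 * (+ 1 * y))
  identity : ∀ x y t →
    + 14 * (+ 2 * (+ 98 * x + + 14 * (+ 33 * y))) + + 196 * (+ 9 * t * (+ 2 * (+ 4 * x + + 14 * (+ 1 * y))))
      ≡ + 49 * (+ 56 * x + + 264 * y + t * (+ 288 * x + + 1008 * y))
  identity = solve-∀
  cross : + 14 * s₁ + + 196 * (+ (9 ℕ.* n) * s₂) ≡ + 2744 * z
  cross = begin
    + 14 * s₁ + + 196 * (+ (9 ℕ.* n) * s₂) ≡⟨ cong (λ k → + 14 * s₁ + + 196 * (k * s₂)) (ℤₚ.pos-* 9 n) ⟩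
    + 14 * s₁ + + 196 * (+ 9 * + n * s₂)   ≡⟨ identity x y (+ n) ⟩
    + 49 * ⟦ form (+ 56) (+ 264) (+ 288) (+ 1008) ⟧ n ≡⟨ cong (+ 49 *_) 56z≡ ⟨
    + 49 * (+ 56 * z)                      ≡⟨ ℤₚ.*-assoc (+ 49) (+ 56) z ⟨
    + 2744 * z                             ∎

sgn-*2 : ∀ k → sgn (k ℕ.* 2) ≡ + 1
sgn-*2 zero    = refl
sgn-*2 (suc k) = trans (ℤₚ.neg-involutive (sgn (k ℕ.* 2))) (sgn-*2 k)

lemma3p3 : (n : ℕ) → n ≥ 1 →
    embℤ (sgn (4 Data.Nat.* n) * b n (4 Data.Nat.* n)) ≡ rhs n
lemma3p3 (suc m) _ = sym (rhs≡embℤ n (sgn (4 ℕ.* n) * b n (4 ℕ.* n)) (begin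
  + 56 * (sgn (4 ℕ.* n) * b n (4 ℕ.* n))
    ≡⟨ cong (λ s → + 56 * (s * b n (4 ℕ.* n))) (trans (cong sgn 4n≡n*2*2) (sgn-*2 (n ℕ.* 2))) ⟩
  + 56 * (+ 1 * b n (4 ℕ.* n))
    ≡⟨ cong (+ 56 *_) (ℤₚ.*-identityˡ (b n (4 ℕ.* n))) ⟩
  + 56 * coeff (charPoly n) (suc (4 ℕ.* n) ℕ.∸ 4 ℕ.* n)
    ≡⟨ cong (λ k → + 56 * coeff (charPoly n) k) (ℕₚ.m+n∸n≡m 1 (4 ℕ.* n)) ⟩
  + 56 * coeff (charPoly n) 1
    ≡⟨ coeff₁-charPoly m ⟩
  ⟦ form (+ 56) (+ 264) (+ 288) (+ 1008) ⟧ n ∎))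
  where
  open ≡-Reasoning
  n = suc m
  4n≡n*2*2 : 4 ℕ.* n ≡ n ℕ.* 2 ℕ.* 2
  4n≡n*2*2 = trans (ℕₚ.*-comm 4 n) (sym (ℕₚ.*-assoc n 2 2))
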